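{- Let $G$ be a finite simple connected graph. Then $G$ is center critical if and only if $G$ is both self centered and a unique eccentric vertex (UEV) graph.
   Context: For vertices $u,v$ of $G=(V,E)$, $d(u,v)$ is the length of a shortest $u$–$v$ path. For a nonempty $S\subseteq V$ and $v\in V$, the $S$-eccentricity is $e_S(v)=\max_{x\in S} d(v,x)$, and the $S$-center is $C_S(G)=\{v\in V: e_S(v)\le e_S(x)\text{ for all }x\in V\}$. The eccentricity of $v$ is $e(v)=e_V(v)$ and the center is $C(G)=C_V(G)$. A vertex $w$ is an eccentric vertex of $u$ if $d(u,w)=e(u)$. $G$ is center critical if $C_S(G)\neq C(G)$ for every nonempty proper subset $S$ of $V$. $G$ is self centered if all vertices have the same eccentricity. $G$ is a UEV graph if every vertex of $G$ has exactly one eccentric vertex. -}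

module Defs where

open import Data.Nat using (ℕ; zero; suc; _≤_)
open import Data.Fin using (Fin)
open import Data.Fin.Subset using (Subset; _∈_; _∉_; ⊤)
open import Data.Product using (Σ; ∃; ∃-syntax; _×_; _,_)
open import Relation.Nullary using (¬_; Dec)
open import Relation.Binary.PropositionalEquality using (_≡_)
open import Function.Bundles using (_⇔_)
open import Level using (0ℓ)

record SimpleGraph (n : ℕ) : Set₁ where
  field
    Adj     : Fin n → Fin n → Set
    symAdj  : ∀ {u v} → Adj u v → Adj v u
    irrefl  : ∀ {u} → ¬ Adj u u
    adj?    : ∀ u v → Dec (Adj u v)

module _ {n : ℕ} (G : SimpleGraph n) where
  open SimpleGraph G

  data Walk : Fin n → Fin n → ℕ → Set where
    here : ∀ {u} → Walk u u zero
    step : ∀ {u v w k} → Adj u v → Walk v w k → Walk u w (suc k)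

  Connected : Set
  Connected = ∀ u v → ∃[ k ] Walk u v k

  Dist : Fin n → Fin n → ℕ → Set
  Dist u v k = Walk u v k × (∀ m → Walk u v m → k ≤ m)

  SEcc : Subset n → Fin n → ℕ → Set
  SEcc S v e = (∀ x k → x ∈ S → Dist v x k → k ≤ e)
             × (∃[ x ] (x ∈ S × Dist v x e))

  InSCenter : Subset n → Fin n → Set
  InSCenter S v = ∀ x ev ex → SEcc S v ev → SEcc S x ex → ev ≤ ex

  Ecc : Fin n → ℕ → Set
  Ecc = SEcc ⊤

  InCenter : Fin n → Set
  InCenter = InSCenter ⊤

  NonemptySub : Subset n → Set
  NonemptySub S = ∃[ x ] x ∈ S

  ProperSub : Subset n → Set
  ProperSub S = ∃[ x ] x ∉ S

  SameCenter : Subset n → Set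
  SameCenter S = ∀ v → InSCenter S v ⇔ InCenter v

  CenterCritical : Set
  CenterCritical = ∀ S → NonemptySub S → ProperSub S → ¬ SameCenter S

  SelfCentered : Set
  SelfCentered = ∀ u v e₁ e₂ → Ecc u e₁ → Ecc v e₂ → e₁ ≡ e₂

  EccentricVertex : Fin n → Fin n → Set
  EccentricVertex u w = ∃[ e ] (Ecc u e × Dist u w e)

  UEV : Set
  UEV = ∀ u → ∃[ w ] (EccentricVertex u w × (∀ w′ → EccentricVertex u w′ → w′ ≡ w))

-- Write f(u) for an eccentric vertex of u.
--
-- (⇐) In a self-centered UEV graph every vertex is central, and d(f u, u) = e(u) = e(f u) shows
-- that u is the unique eccentric vertex of f u. Given a nonempty proper S, pick y ∈ S and x ∉ S.
-- Then e_S(f y) = e(f y), while e_S(f x) < e(f x) because the only vertex at distance e(f x) from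
-- f x is x ∉ S. As all eccentricities agree, f y lies in C(G) but not in C_S(G).
--
-- (⇒) If no vertex has x as its unique eccentric vertex, then deleting x from V changes no
-- eccentricity, so C_{V∖x}(G) = C(G). Hence in a center critical graph every x is the unique
-- eccentric vertex of some vertex; by finiteness this correspondence is a bijection, which gives
-- UEV. Along an edge ab with e(a) = e(b) + 1 the eccentric vertex of a would also be the unique
-- eccentric vertex of b, forcing a = b; so eccentricity is constant on edges, hence on the
-- connected graph G.
module Submission where

open import Defs
open import Data.Nat using (ℕ; zero; suc; _+_; _≤_; _<_; _⊔_; z≤n; _≟_)
open import Data.Nat.Properties
  using (≤-antisym; ≤-trans; ≤-reflexive; ≤-pred; ≮⇒≥; ≤∧≢⇒<; <-irrefl; 1+n≰n; +-suc; +-comm;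
         +-identityʳ; m<1+n⇒m<n∨m≡n; ⊔-lub; ⊔-sel; m≤m⊔n; m≤n⊔m; module ≤-Reasoning)
open import Data.Fin using (Fin; zero; suc; punchOut) renaming (_≟_ to _≟ᶠ_)
open import Data.Fin.Properties using (any?; all?; injective⇒≤; punchOut-injective)
open import Data.Fin.Subset using (Subset; Nonempty; _∈_; ⊤; ∁; ⁅_⁆; inside; outside)
open import Data.Fin.Subset.Properties using (∈⊤; x∈⁅x⁆; x≢y⇒x∉⁅y⁆; x∈p⇒x∉∁p; x∉p⇒x∈∁p)
open import Data.Vec using ([]; _∷_; here; there)
open import Data.Product using (∃; ∃-syntax; _×_; _,_; proj₁; proj₂)
open import Data.Sum using (_⊎_; inj₁; inj₂)
open import Data.Empty using (⊥-elim)
open import Function using (_∘_)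
open import Function.Bundles using (_⇔_; mk⇔; Equivalence)
open import Relation.Nullary using (¬_; Dec; yes; no; contradiction)
open import Relation.Nullary.Decidable using (_×-dec_; _→-dec_; ¬?; decidable-stable)
open import Relation.Unary using (Decidable)
open import Relation.Binary.PropositionalEquality
  using (_≡_; _≢_; refl; sym; trans; cong; subst; subst₂)

module _ {P : ℕ → Set} (P? : Decidable P) where

  least-from : ∀ j k → P (k + j) → (∀ m → m < j → ¬ P m) →
               ∃[ l ] (P l × (∀ m → P m → l ≤ m))
  least-from j k pk below with P? j
  ... | yes pj = j , pj , λ m pm → ≮⇒≥ (λ m<j → below m m<j pm)
  least-from j zero    pj below | no ¬pj = contradiction pj ¬pj
  least-from j (suc k) pk below | no ¬pj =
    least-from (suc j) k (subst P (sym (+-suc k j)) pk) below′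
    where
    below′ : ∀ m → m < suc j → ¬ P m
    below′ m m<1+j with m<1+n⇒m<n∨m≡n m<1+j
    ... | inj₁ m<j  = below m m<j
    ... | inj₂ refl = ¬pj

  least-witness : ∀ {k} → P k → ∃[ l ] (P l × (∀ m → P m → l ≤ m))
  least-witness {k} pk = least-from 0 k (subst P (sym (+-identityʳ k)) pk) (λ _ ())

maxOn : ∀ {m} → (Fin m → ℕ) → Subset m → ℕ
maxOn h []            = 0
maxOn h (inside ∷ S)  = h zero ⊔ maxOn (h ∘ suc) S
maxOn h (outside ∷ S) = maxOn (h ∘ suc) S

maxOn-upperBound : ∀ {m} (h : Fin m → ℕ) (S : Subset m) {x} → x ∈ S → h x ≤ maxOn h S
maxOn-upperBound h (inside ∷ S)  here      = m≤m⊔n (h zero) _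
maxOn-upperBound h (inside ∷ S)  (there p) = ≤-trans (maxOn-upperBound (h ∘ suc) S p) (m≤n⊔m (h zero) _)
maxOn-upperBound h (outside ∷ S) (there p) = maxOn-upperBound (h ∘ suc) S p

maxOn-least : ∀ {m} (h : Fin m → ℕ) (S : Subset m) {b} → (∀ x → x ∈ S → h x ≤ b) → maxOn h S ≤ b
maxOn-least h []            ub = z≤n
maxOn-least h (inside ∷ S)  ub = ⊔-lub (ub zero here) (maxOn-least (h ∘ suc) S (λ x → ub (suc x) ∘ there))
maxOn-least h (outside ∷ S) ub = maxOn-least (h ∘ suc) S (λ x → ub (suc x) ∘ there)

maxOn≡0⊎attained : ∀ {m} (h : Fin m → ℕ) (S : Subset m) →
                   maxOn h S ≡ 0 ⊎ ∃[ y ] (y ∈ S × h y ≡ maxOn h S)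
maxOn≡0⊎attained h [] = inj₁ refl
maxOn≡0⊎attained h (outside ∷ S) with maxOn≡0⊎attained (h ∘ suc) S
... | inj₁ ≡0              = inj₁ ≡0
... | inj₂ (y , y∈S , hy≡) = inj₂ (suc y , there y∈S , hy≡)
maxOn≡0⊎attained h (inside ∷ S) with ⊔-sel (h zero) (maxOn (h ∘ suc) S)
... | inj₁ ⊔≡h0 = inj₂ (zero , here , sym ⊔≡h0)
... | inj₂ ⊔≡mx with maxOn≡0⊎attained (h ∘ suc) S
...   | inj₁ ≡0              = inj₁ (trans ⊔≡mx ≡0)
...   | inj₂ (y , y∈S , hy≡) = inj₂ (suc y , there y∈S , trans hy≡ (sym ⊔≡mx))

maxOn-attained : ∀ {m} (h : Fin m → ℕ) (S : Subset m) → Nonempty S →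
                 ∃[ y ] (y ∈ S × h y ≡ maxOn h S)
maxOn-attained h S (x , x∈S) with maxOn≡0⊎attained h S
... | inj₂ attained = attained
... | inj₁ ≡0 = x , x∈S , ≤-antisym (maxOn-upperBound h S x∈S) (subst (_≤ h x) (sym ≡0) z≤n)

injective⇒surjective : ∀ {m} (g : Fin m → Fin m) → (∀ {a b} → g a ≡ g b → a ≡ b) →
                       ∀ y → ∃[ x ] g x ≡ y
injective⇒surjective {zero}  g g-inj ()
injective⇒surjective {suc m} g g-inj y with any? (λ x → g x ≟ᶠ y)
... | yes hit = hit
... | no miss = ⊥-elim (1+n≰n (injective⇒≤ {f = g′} g′-inj))
  where
  g′ : Fin (suc m) → Fin m
  g′ x = punchOut {i = y} (λ y≡gx → miss (x , sym y≡gx))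
  g′-inj : ∀ {a b} → g′ a ≡ g′ b → a ≡ b
  g′-inj {a} {b} = g-inj ∘ punchOut-injective (λ q → miss (a , sym q)) (λ q → miss (b , sym q))

module _ {n : ℕ} (G : SimpleGraph n) where
  open SimpleGraph G

  walk? : ∀ k u v → Dec (Walk G u v k)
  walk? zero u v with u ≟ᶠ v
  ... | yes refl = yes here
  ... | no u≢v   = no λ { here → u≢v refl }
  walk? (suc k) u v with any? (λ w → adj? u w ×-dec walk? k w v)
  ... | yes (w , u~w , p) = yes (step u~w p)
  ... | no none           = no λ { (step u~w p) → none (_ , u~w , p) }

  _++ʷ_ : ∀ {u v w a b} → Walk G u v a → Walk G v w b → Walk G u w (a + b)
  here     ++ʷ q = q
  step x p ++ʷ q = step x (p ++ʷ q)

  reverseʷ : ∀ {u v a} → Walk G u v a → Walk G v u a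
  reverseʷ here                = here
  reverseʷ (step {k = k} x p) = subst (Walk G _ _) (+-comm k 1) (reverseʷ p ++ʷ step (symAdj x) here)

module Eccentricity {n : ℕ} (G : SimpleGraph n) (conn : Connected G) where
  open SimpleGraph G

  -- Opaque so that dist u v is a rigid term from which u and v can be inferred.
  opaque
    shortestWalk : ∀ u v → ∃ (Dist G u v)
    shortestWalk u v = least-witness (λ k → walk? G k u v) (proj₂ (conn u v))

  dist : Fin n → Fin n → ℕ
  dist u v = proj₁ (shortestWalk u v)

  dist-isDist : ∀ u v → Dist G u v (dist u v)
  dist-isDist u v = proj₂ (shortestWalk u v)

  Dist⇒≡dist : ∀ {u v k} → Dist G u v k → k ≡ dist u v
  Dist⇒≡dist {u} {v} (p , p-min) = ≤-antisym (p-min _ (proj₁ (dist-isDist u v))) (proj₂ (dist-isDist u v) _ p)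

  dist-sym : ∀ u v → dist u v ≡ dist v u
  dist-sym u v = ≤-antisym (proj₂ (dist-isDist u v) _ (reverseʷ G (proj₁ (dist-isDist v u))))
                           (proj₂ (dist-isDist v u) _ (reverseʷ G (proj₁ (dist-isDist u v))))

  dist-adj : ∀ {a b} w → Adj a b → dist a w ≤ suc (dist b w)
  dist-adj {a} {b} w a~b = proj₂ (dist-isDist a w) _ (step a~b (proj₁ (dist-isDist b w)))

  eccOn : Subset n → Fin n → ℕ
  eccOn S v = maxOn (dist v) S

  ecc : Fin n → ℕ
  ecc = eccOn ⊤

  dist≤eccOn : ∀ {S} v {w} → w ∈ S → dist v w ≤ eccOn S v
  dist≤eccOn {S} v = maxOn-upperBound (dist v) S

  dist≤ecc : ∀ v w → dist v w ≤ ecc v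
  dist≤ecc v w = dist≤eccOn v ∈⊤

  eccOn≤ecc : ∀ S v → eccOn S v ≤ ecc v
  eccOn≤ecc S v = maxOn-least (dist v) S (λ w _ → dist≤ecc v w)

  ecc-attained : ∀ v → ∃[ w ] dist v w ≡ ecc v
  ecc-attained v with maxOn-attained (dist v) ⊤ (v , ∈⊤)
  ... | w , _ , dvw≡ = w , dvw≡

  SEcc-eccOn : ∀ {S} v → Nonempty S → SEcc G S v (eccOn S v)
  SEcc-eccOn {S} v S≠∅ with maxOn-attained (dist v) S S≠∅
  ... | w , w∈S , dvw≡ =
    (λ x k x∈S D → subst (_≤ eccOn S v) (sym (Dist⇒≡dist D)) (dist≤eccOn v x∈S)) ,
    (w , w∈S , subst (Dist G v w) dvw≡ (dist-isDist v w))

  SEcc⇒≡eccOn : ∀ {S v k} → SEcc G S v k → k ≡ eccOn S v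
  SEcc⇒≡eccOn {S} {v} (bound , w , w∈S , D) = ≤-antisym
    (subst (_≤ eccOn S v) (sym (Dist⇒≡dist D)) (dist≤eccOn v w∈S))
    (maxOn-least (dist v) S (λ x x∈S → bound x _ x∈S (dist-isDist v x)))

  inSCenter⇔eccOn-minimal : ∀ {S} v → Nonempty S → InSCenter G S v ⇔ (∀ u → eccOn S v ≤ eccOn S u)
  inSCenter⇔eccOn-minimal {S} v S≠∅ = mk⇔
    (λ central u → central u _ _ (SEcc-eccOn v S≠∅) (SEcc-eccOn u S≠∅))
    (λ minimal u _ _ Ev Eu → subst₂ _≤_ (sym (SEcc⇒≡eccOn Ev)) (sym (SEcc⇒≡eccOn Eu)) (minimal u))

  inCenter⇔ecc-minimal : ∀ v → InCenter G v ⇔ (∀ u → ecc v ≤ ecc u)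
  inCenter⇔ecc-minimal v = inSCenter⇔eccOn-minimal v (v , ∈⊤)

  sameCenter-if-eccOn≡ecc : ∀ {S} → Nonempty S → (∀ v → eccOn S v ≡ ecc v) → SameCenter G S
  sameCenter-if-eccOn≡ecc {S} S≠∅ eccOn≡ecc v = mk⇔
    (λ central → from (inCenter⇔ecc-minimal v) λ u →
      subst₂ _≤_ (eccOn≡ecc v) (eccOn≡ecc u) (to (inSCenter⇔eccOn-minimal v S≠∅) central u))
    (λ central → from (inSCenter⇔eccOn-minimal v S≠∅) λ u →
      subst₂ _≤_ (sym (eccOn≡ecc v)) (sym (eccOn≡ecc u)) (to (inCenter⇔ecc-minimal v) central u))
    where open Equivalence

  selfCentered⇔ecc-constant : SelfCentered G ⇔ (∀ u v → ecc u ≡ ecc v)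
  selfCentered⇔ecc-constant = mk⇔
    (λ sc u v → sc u v _ _ (SEcc-eccOn u (u , ∈⊤)) (SEcc-eccOn v (v , ∈⊤)))
    (λ const u v _ _ Eu Ev → trans (SEcc⇒≡eccOn Eu) (trans (const u v) (sym (SEcc⇒≡eccOn Ev))))

  eccentricVertex⇔ : ∀ {u w} → EccentricVertex G u w ⇔ dist u w ≡ ecc u
  eccentricVertex⇔ {u} {w} = mk⇔
    (λ (_ , Eu , D) → trans (sym (Dist⇒≡dist D)) (SEcc⇒≡eccOn Eu))
    (λ duw≡ → ecc u , SEcc-eccOn u (u , ∈⊤) , subst (Dist G u w) duw≡ (dist-isDist u w))

  IsUniqueEccentric : Fin n → Fin n → Set
  IsUniqueEccentric u w = dist u w ≡ ecc u × (∀ w′ → dist u w′ ≡ ecc u → w′ ≡ w)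

  isUniqueEccentric? : ∀ u w → Dec (IsUniqueEccentric u w)
  isUniqueEccentric? u w = (dist u w ≟ ecc u) ×-dec all? (λ w′ → (dist u w′ ≟ ecc u) →-dec (w′ ≟ᶠ w))

  isUniqueEccentric-functional : ∀ {u w w′} → IsUniqueEccentric u w → IsUniqueEccentric u w′ → w ≡ w′
  isUniqueEccentric-functional (_ , unique) (duw′≡ , _) = sym (unique _ duw′≡)

  isUniqueEccentric-resp : ∀ {u w w′} → IsUniqueEccentric u w → dist u w′ ≡ ecc u → IsUniqueEccentric u w′
  isUniqueEccentric-resp (_ , unique) duw′≡ =
    duw′≡ , λ w″ duw″≡ → trans (unique w″ duw″≡) (sym (unique _ duw′≡))

  UEV⇔isUniqueEccentric-total : UEV G ⇔ (∀ u → ∃ (IsUniqueEccentric u))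
  UEV⇔isUniqueEccentric-total = mk⇔
    (λ uev u → convert (to eccentricVertex⇔) (from eccentricVertex⇔) (uev u))
    (λ total u → convert (from eccentricVertex⇔) (to eccentricVertex⇔) (total u))
    where
    open Equivalence
    convert : ∀ {A B : Fin n → Set} → (∀ {w} → A w → B w) → (∀ {w} → B w → A w) →
              ∃[ w ] (A w × (∀ w′ → A w′ → w′ ≡ w)) → ∃[ w ] (B w × (∀ w′ → B w′ → w′ ≡ w))
    convert A⇒B B⇒A (w , a , unique) = w , A⇒B a , λ w′ → unique w′ ∘ B⇒A

  eccOn<ecc : ∀ {S} v → Nonempty S → (∀ w → w ∈ S → dist v w ≢ ecc v) → eccOn S v < ecc v
  eccOn<ecc {S} v S≠∅ noEccentric with maxOn-attained (dist v) S S≠∅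
  ... | w , w∈S , dvw≡ = subst (_< ecc v) dvw≡ (≤∧≢⇒< (dist≤ecc v w) (noEccentric w w∈S))

  eccentric-sym : (∀ u v → ecc u ≡ ecc v) → ∀ {u w} → dist u w ≡ ecc u → dist w u ≡ ecc w
  eccentric-sym const {u} {w} duw≡ = trans (dist-sym w u) (trans duw≡ (const u w))

  selfCentered×UEV⇒centerCritical : SelfCentered G × UEV G → CenterCritical G
  selfCentered×UEV⇒centerCritical (sc , uev) S S≠∅@(y , y∈S) (x , x∉S) sameCenter =
    <-irrefl refl (begin-strict
      ecc fy        ≡⟨ sym (eccentric-sym const (proj₁ (proj₂ (f-ecc y)))) ⟩
      dist fy y     ≤⟨ dist≤eccOn fy y∈S ⟩
      eccOn S fy    ≤⟨ to (inSCenter⇔eccOn-minimal fy S≠∅) fy∈C_S fx ⟩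
      eccOn S fx    <⟨ eccOn<ecc fx S≠∅ (λ t t∈S dt≡ → x∉S (subst (_∈ S) (only-x t dt≡) t∈S)) ⟩
      ecc fx        ≡⟨ const fx fy ⟩
      ecc fy        ∎)
    where
    open ≤-Reasoning
    open Equivalence
    const : ∀ u v → ecc u ≡ ecc v
    const = to selfCentered⇔ecc-constant sc
    f-ecc : ∀ u → ∃ (IsUniqueEccentric u)
    f-ecc = to UEV⇔isUniqueEccentric-total uev
    fy = proj₁ (f-ecc y)
    fx = proj₁ (f-ecc x)
    fy∈C_S : InSCenter G S fy
    fy∈C_S = from (sameCenter fy) (from (inCenter⇔ecc-minimal fy) (λ u → ≤-reflexive (const fy u)))
    only-x : ∀ t → dist fx t ≡ ecc fx → t ≡ x
    only-x = proj₂ (isUniqueEccentric-resp (proj₂ (f-ecc fx)) (eccentric-sym const (proj₁ (proj₂ (f-ecc x)))))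

  isUniqueEccentric⊎otherEccentric : ∀ v x → IsUniqueEccentric v x ⊎ ∃[ t ] (t ≢ x × dist v t ≡ ecc v)
  isUniqueEccentric⊎otherEccentric v x with any? (λ t → ¬? (t ≟ᶠ x) ×-dec (dist v t ≟ ecc v))
  ... | yes other = inj₂ other
  ... | no ¬other = inj₁ (subst (λ t → dist v t ≡ ecc v) (only-x t dvt≡) dvt≡ , only-x)
    where
    only-x : ∀ t → dist v t ≡ ecc v → t ≡ x
    only-x t dvt≡ = decidable-stable (t ≟ᶠ x) (λ t≢x → ¬other (t , t≢x , dvt≡))
    t = proj₁ (ecc-attained v)
    dvt≡ = proj₂ (ecc-attained v)

  centerCritical⇒isUniqueEccentric-surjective : CenterCritical G → ∀ x → ∃[ v ] IsUniqueEccentric v x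
  centerCritical⇒isUniqueEccentric-surjective cc x with any? (λ v → isUniqueEccentric? v x)
  ... | yes found = found
  ... | no none = ⊥-elim (cc S S≠∅ (x , x∈p⇒x∉∁p (x∈⁅x⁆ x)) (sameCenter-if-eccOn≡ecc S≠∅ eccOn≡ecc))
    where
    S : Subset n
    S = ∁ ⁅ x ⁆
    otherEccentric : ∀ v → ∃[ t ] (t ≢ x × dist v t ≡ ecc v)
    otherEccentric v with isUniqueEccentric⊎otherEccentric v x
    ... | inj₁ unique = ⊥-elim (none (v , unique))
    ... | inj₂ other  = other
    S≠∅ : Nonempty S
    S≠∅ = let (t , t≢x , _) = otherEccentric x in t , x∉p⇒x∈∁p (x≢y⇒x∉⁅y⁆ t≢x)
    eccOn≡ecc : ∀ v → eccOn S v ≡ ecc v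
    eccOn≡ecc v = let (t , t≢x , dvt≡) = otherEccentric v in
      ≤-antisym (eccOn≤ecc S v) (subst (_≤ eccOn S v) dvt≡ (dist≤eccOn v (x∉p⇒x∈∁p (x≢y⇒x∉⁅y⁆ t≢x))))

  module _ (surjective : ∀ x → ∃[ v ] IsUniqueEccentric v x) where
    private
      g : Fin n → Fin n
      g x = proj₁ (surjective x)

      g-injective : ∀ {x x′} → g x ≡ g x′ → x ≡ x′
      g-injective {x} {x′} gx≡gx′ = isUniqueEccentric-functional (proj₂ (surjective x))
        (subst (λ v → IsUniqueEccentric v x′) (sym gx≡gx′) (proj₂ (surjective x′)))

      ≡g : ∀ {u w} → IsUniqueEccentric u w → u ≡ g w
      ≡g {u} {w} ue with injective⇒surjective g g-injective u
      ... | p , refl = cong g (isUniqueEccentric-functional (proj₂ (surjective p)) ue)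

    isUniqueEccentric-total : ∀ u → ∃ (IsUniqueEccentric u)
    isUniqueEccentric-total u with injective⇒surjective g g-injective u
    ... | p , refl = p , proj₂ (surjective p)

    isUniqueEccentric-injective : ∀ {a b w} → IsUniqueEccentric a w → IsUniqueEccentric b w → a ≡ b
    isUniqueEccentric-injective a-ue b-ue = trans (≡g a-ue) (sym (≡g b-ue))

    adjacent⇒ecc≤ : ∀ {a b} → Adj a b → ecc a ≤ ecc b
    adjacent⇒ecc≤ {a} {b} a~b = ≮⇒≥ λ eb<ea →
      let (w , a-ue) = isUniqueEccentric-total a
          dbw≡ : dist b w ≡ ecc b
          dbw≡ = ≤-antisym (dist≤ecc b w)
                   (≤-pred (≤-trans eb<ea (subst (_≤ suc (dist b w)) (proj₁ a-ue) (dist-adj w a~b))))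
          b-ue = isUniqueEccentric-resp (proj₂ (isUniqueEccentric-total b)) dbw≡
      in irrefl (subst (Adj a) (sym (isUniqueEccentric-injective a-ue b-ue)) a~b)

    ecc-constant-along-walk : ∀ {u v k} → Walk G u v k → ecc u ≡ ecc v
    ecc-constant-along-walk here         = refl
    ecc-constant-along-walk (step u~w p) =
      trans (≤-antisym (adjacent⇒ecc≤ u~w) (adjacent⇒ecc≤ (symAdj u~w))) (ecc-constant-along-walk p)

  centerCritical⇒selfCentered×UEV : CenterCritical G → SelfCentered G × UEV G
  centerCritical⇒selfCentered×UEV cc =
    Equivalence.from selfCentered⇔ecc-constant (λ u v → ecc-constant-along-walk surjective (proj₂ (conn u v))) ,
    Equivalence.from UEV⇔isUniqueEccentric-total (isUniqueEccentric-total surjective)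
    where
    surjective = centerCritical⇒isUniqueEccentric-surjective cc

mainTheorem1 : ∀ {n : ℕ} (G : SimpleGraph n) → Connected G →
    CenterCritical G ⇔ (SelfCentered G × UEV G)
mainTheorem1 G conn = mk⇔ centerCritical⇒selfCentered×UEV selfCentered×UEV⇒centerCritical
  where open Eccentricity G conn
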